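{- Let $B$ be a board in the square grid and let $Ad(B)$ be its adjacency graph. Then $d(B) = |B| - \gamma(Ad(B))$, where $|B|$ is the number of cells of $B$.
   Context: Work in the square grid: cells are unit squares with integer corners, and two cells are neighbors if they share an edge. A board is a finite set $B$ of cells such that every cell of $B$ has at least one neighbor in $B$. The adjacency graph $Ad(B)$ has the cells of $B$ as vertices, two being joined by an edge if they are neighbors. A domino is a set of two adjacent cells. A domino covering of $B$ is a finite collection (repetitions allowed) of dominoes, each contained in $B$, whose union is $B$; it is saturated if removing any single domino leaves some cell uncovered. $d(B)$ is the largest number of dominoes in a saturated domino covering of $B$. For a graph $G$, $\gamma(G)$ is its domination number: the minimum size of a set $S$ of vertices such that every vertex lies in $S$ or is adjacent to a vertex of $S$. -}

module Defs where

open import Data.Integer using (ℤ; _+_; +_)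
open import Data.Product using (_×_; _,_; Σ; ∃; ∃-syntax; proj₁; proj₂)
open import Data.Sum using (_⊎_)
open import Relation.Binary.PropositionalEquality using (_≡_)
open import Relation.Nullary using (¬_)
open import Data.Nat using (ℕ; _≤_)
open import Data.Fin using (Fin)
open import Data.List using (List; length; removeAt)
open import Data.List.Membership.Propositional using (_∈_; _∉_)
open import Data.List.Relation.Unary.All using (All)
open import Data.List.Relation.Unary.Any using (Any)
open import Data.List.Relation.Unary.Unique.Propositional using (Unique)

-- A cell is identified by its lower-left integer corner (x , y).
Cell : Set
Cell = ℤ × ℤ

data Adj : Cell → Cell → Set where
  right : ∀ x y → Adj (x , y) (x + + 1 , y)
  left  : ∀ x y → Adj (x + + 1 , y) (x , y)
  up    : ∀ x y → Adj (x , y) (x , y + + 1)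
  down  : ∀ x y → Adj (x , y + + 1) (x , y)

record CellSet : Set where
  constructor mkCellSet
  field
    cells  : List Cell
    unique : Unique cells
open CellSet public

IsBoard : CellSet → Set
IsBoard B = ∀ {c} → c ∈ cells B → ∃[ c′ ] (c′ ∈ cells B × Adj c c′)

record Domino : Set where
  constructor mkDomino
  field
    fst : Cell
    snd : Cell
    adj : Adj fst snd
open Domino public

_∈ᴰ_ : Cell → Domino → Set
c ∈ᴰ δ = (c ≡ fst δ) ⊎ (c ≡ snd δ)

DominoIn : CellSet → Domino → Set
DominoIn B δ = (fst δ ∈ cells B) × (snd δ ∈ cells B)

Covered : List Domino → Cell → Set
Covered D c = Any (c ∈ᴰ_) D

-- A domino covering of B: a finite collection (repetitions allowed) of
-- dominoes contained in B whose union is B.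
IsCovering : CellSet → List Domino → Set
IsCovering B D = All (DominoIn B) D × (∀ {c} → c ∈ cells B → Covered D c)

IsSaturatedCovering : CellSet → List Domino → Set
IsSaturatedCovering B D =
  IsCovering B D ×
  ((i : Fin (length D)) → ∃[ c ] (c ∈ cells B × ¬ Covered (removeAt D i) c))

IsMaxSaturatedSize : CellSet → ℕ → Set
IsMaxSaturatedSize B n =
  (∃[ D ] (IsSaturatedCovering B D × length D ≡ n)) ×
  (∀ D → IsSaturatedCovering B D → length D ≤ n)

-- Adjacency graph Ad(B): vertices are cells of B, edges join neighbours.
-- S is a dominating set of Ad(B).
IsDominatingSet : CellSet → CellSet → Set
IsDominatingSet B S =
  All (_∈ cells B) (cells S) ×
  (∀ {v} → v ∈ cells B → (v ∈ cells S) ⊎ ∃[ u ] (u ∈ cells S × Adj v u))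

IsDominationNumber : CellSet → ℕ → Set
IsDominationNumber B g =
  (∃[ S ] (IsDominatingSet B S × length (cells S) ≡ g)) ×
  (∀ S → IsDominatingSet B S → g ≤ length (cells S))

-- Upper bound: in a saturated covering every domino has a private cell, covered by no
-- other domino.  The partner of a private cell inside its domino is not private, so the
-- cells that are not private dominate Ad(B); hence γ ≤ |B| − #dominoes.
--
-- Lower bound: let S be a minimum dominating set.  Because B has no isolated cell and S is
-- minimum, each cell v outside S can be sent to an S-neighbour p v so that every cell of S is hit
-- (an unhit s ∈ S either could be dropped from S, or a neighbour w ∉ S of s can be
-- redirected to s, or S − {s, p w} + {w} would be a smaller dominating set).  The dominoes
-- {v , p v} for v ∉ S then form a saturated covering with |B| − |S| dominoes, each v being
-- private to its domino.
module Submission where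

open import Defs
open import Data.Nat using (ℕ; _∸_; suc; _+_; _≤_; _<_; z≤n; s≤s)
open import Data.Nat.Properties
  using (≤-trans; ≤-antisym; <⇒≱; +-suc; +-comm; +-monoˡ-≤; +-monoʳ-≤; m+n≤o⇒m≤o∸n; m≤n+o⇒m∸n≤o; module ≤-Reasoning)
open import Data.Integer using (ℤ; 0ℤ; 1ℤ) renaming (_+_ to _+ℤ_)
import Data.Integer.Properties as ℤ
open import Data.Product using (_×_; _,_; ∃; ∃-syntax; proj₁; proj₂)
open import Data.Product.Properties using (≡-dec)
open import Data.Sum using (_⊎_; inj₁; inj₂)
open import Data.Empty using (⊥; ⊥-elim)
open import Data.Fin using (Fin; zero; suc)
import Data.Fin.Properties as Fin
open import Data.List using (List; []; _∷_; length; filter; removeAt; lookup; tabulate; map)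
open import Data.List.Properties using (filter-notAll; length-tabulate; length-map)
open import Data.List.Membership.Propositional using (_∈_; _∉_; mapWith∈; find; lose)
open import Data.List.Membership.Propositional.Properties
  using (∈-filter⁺; ∈-filter⁻; ∈-tabulate⁻; ∈-lookup; ∈-map⁺; mapWith∈-id; map-mapWith∈)
open import Data.List.Relation.Binary.Subset.Propositional using (_⊆_)
open import Data.List.Relation.Unary.All using (All; _∷_)
import Data.List.Relation.Unary.All as All
import Data.List.Relation.Unary.All.Properties as All
open import Data.List.Relation.Unary.Any using (Any; here; there; any?)
import Data.List.Relation.Unary.Any as Any
import Data.List.Relation.Unary.Any.Properties as Any
open import Data.List.Relation.Unary.AllPairs using (_∷_)
open import Data.List.Relation.Unary.Unique.Propositional using (Unique)
import Data.List.Relation.Unary.Unique.Propositional.Properties as Unique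
open import Function using (_∘_; const)
open import Relation.Binary.Definitions using (DecidableEquality)
open import Relation.Binary.PropositionalEquality
open import Relation.Nullary using (Dec; yes; no; ¬_)
open import Relation.Nullary.Decidable using (¬?; _×-dec_)
open import Relation.Unary using (Pred; Decidable)
open import Relation.Unary.Properties using (∁?)

module _ {a p} {A : Set a} {P : Pred A p} (P? : Decidable P) where

  length-filter+length-filter-∁ : ∀ xs → length (filter P? xs) + length (filter (∁? P?) xs) ≡ length xs
  length-filter+length-filter-∁ [] = refl
  length-filter+length-filter-∁ (x ∷ xs) with P? x
  ... | yes _ = cong suc (length-filter+length-filter-∁ xs)
  ... | no _ = trans (+-suc _ _) (cong suc (length-filter+length-filter-∁ xs))

module WithDecidableEquality {a} {A : Set a} (_≟_ : DecidableEquality A) where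

  open import Data.List.Membership.DecPropositional _≟_ using (_∈?_; _∉?_)

  remove : A → List A → List A
  remove x = filter (λ y → ¬? (y ≟ x))

  ∈-remove⁺ : ∀ {x y xs} → y ∈ xs → y ≢ x → y ∈ remove x xs
  ∈-remove⁺ = ∈-filter⁺ _

  ∈-remove⁻ : ∀ {x y xs} → y ∈ remove x xs → y ∈ xs
  ∈-remove⁻ = proj₁ ∘ ∈-filter⁻ _

  remove-unique : ∀ {x xs} → Unique xs → Unique (remove x xs)
  remove-unique = Unique.filter⁺ _

  length-remove< : ∀ {x xs} → x ∈ xs → length (remove x xs) < length xs
  length-remove< x∈xs = filter-notAll _ _ (Any.map (λ x≡y y≢x → y≢x (sym x≡y)) x∈xs)

  unique⊆⇒length≤ : ∀ {xs ys} → Unique xs → xs ⊆ ys → length xs ≤ length ys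
  unique⊆⇒length≤ {[]} _ _ = z≤n
  unique⊆⇒length≤ {x ∷ xs} {ys} (x∉xs ∷ xs!) x∷xs⊆ys =
    ≤-trans (s≤s (unique⊆⇒length≤ xs! xs⊆ys-x)) (length-remove< (x∷xs⊆ys (here refl)))
    where
    xs⊆ys-x : xs ⊆ remove x ys
    xs⊆ys-x y∈xs = ∈-remove⁺ (x∷xs⊆ys (there y∈xs)) (λ y≡x → All.lookup x∉xs y∈xs (sym y≡x))

  unique⊆⇒length+length-∉≤ : ∀ {xs ys} → Unique xs → xs ⊆ ys →
                              length xs + length (filter (_∉? xs) ys) ≤ length ys
  unique⊆⇒length+length-∉≤ {xs} {ys} xs! xs⊆ys = begin
    length xs + length (filter (_∉? xs) ys)                       ≤⟨ +-monoˡ-≤ _ xs≤ys∩xs ⟩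
    length (filter (_∈? xs) ys) + length (filter (_∉? xs) ys)     ≡⟨ length-filter+length-filter-∁ (_∈? xs) ys ⟩
    length ys                                                     ∎
    where
    open ≤-Reasoning
    xs≤ys∩xs : length xs ≤ length (filter (_∈? xs) ys)
    xs≤ys∩xs = unique⊆⇒length≤ xs! (λ x∈xs → ∈-filter⁺ (_∈? xs) (xs⊆ys x∈xs) x∈xs)

  unique⇒length≤length+length-∉ : ∀ xs {ys} → Unique ys →
                                  length ys ≤ length xs + length (filter (_∉? xs) ys)
  unique⇒length≤length+length-∉ xs {ys} ys! = begin
    length ys                                                     ≡⟨ length-filter+length-filter-∁ (_∈? xs) ys ⟨
    length (filter (_∈? xs) ys) + length (filter (_∉? xs) ys)     ≤⟨ +-monoˡ-≤ _ ys∩xs≤xs ⟩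
    length xs + length (filter (_∉? xs) ys)                       ∎
    where
    open ≤-Reasoning
    ys∩xs≤xs : length (filter (_∈? xs) ys) ≤ length xs
    ys∩xs≤xs = unique⊆⇒length≤ (Unique.filter⁺ (_∈? xs) ys!) (proj₂ ∘ ∈-filter⁻ (_∈? xs) {xs = ys})

  _[_≔_] : ∀ {b} {B : Set b} → (A → B) → A → B → A → B
  (f [ x ≔ y ]) z with z ≟ x
  ... | yes _ = y
  ... | no _ = f z

  update-≡ : ∀ {b} {B : Set b} (f : A → B) {x y} → (f [ x ≔ y ]) x ≡ y
  update-≡ f {x} with x ≟ x
  ... | yes _ = refl
  ... | no x≢x = ⊥-elim (x≢x refl)

  update-≢ : ∀ {b} {B : Set b} (f : A → B) {x y z} → z ≢ x → (f [ x ≔ y ]) z ≡ f z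
  update-≢ f {x} {z = z} z≢x with z ≟ x
  ... | yes z≡x = ⊥-elim (z≢x z≡x)
  ... | no _ = refl

  finiteChoice : ∀ {b r} {B : Set b} {R : A → B → Set r} → B → (xs : List A) →
                 (∀ {x} → x ∈ xs → ∃ (R x)) → ∃[ f ] (∀ {x} → x ∈ xs → R x (f x))
  finiteChoice default [] _ = const default , λ ()
  finiteChoice {R = R} default (x ∷ xs) choose
    with finiteChoice default xs (choose ∘ there) | choose (here refl)
  ... | f , Rf | y , Rxy = f [ x ≔ y ] , R-updated
    where
    R-updated : ∀ {z} → z ∈ x ∷ xs → R z ((f [ x ≔ y ]) z)
    R-updated {z} z∈ with z ≟ x
    ... | yes refl = Rxy
    ... | no z≢x = Rf (Any.tail z≢x z∈)

Any-removeAt⁺ : ∀ {a p} {A : Set a} {P : Pred A p} (xs : List A) (i j : Fin (length xs)) →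
                j ≢ i → P (lookup xs j) → Any P (removeAt xs i)
Any-removeAt⁺ (x ∷ xs) zero zero j≢i _ = ⊥-elim (j≢i refl)
Any-removeAt⁺ (x ∷ xs) zero (suc j) _ Pxⱼ = lose (∈-lookup j) Pxⱼ
Any-removeAt⁺ (x ∷ xs) (suc i) zero _ Px = here Px
Any-removeAt⁺ (x ∷ xs) (suc i) (suc j) j≢i Pxⱼ = there (Any-removeAt⁺ xs i j (j≢i ∘ cong suc) Pxⱼ)

_≟ᶜ_ : DecidableEquality Cell
_≟ᶜ_ = ≡-dec ℤ._≟_ ℤ._≟_

open import Data.List.Membership.DecPropositional _≟ᶜ_ using (_∈?_; _∉?_)
open WithDecidableEquality _≟ᶜ_

Adj-sym : ∀ {c c′} → Adj c c′ → Adj c′ c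
Adj-sym (right x y) = left x y
Adj-sym (left x y) = right x y
Adj-sym (up x y) = down x y
Adj-sym (down x y) = up x y

i≢i+1 : ∀ (i : ℤ) → i ≢ i +ℤ 1ℤ
i≢i+1 i i≡i+1 = ℤ.i≢suc[i] (trans i≡i+1 (ℤ.+-comm i 1ℤ))

Adj⇒≢ : ∀ {c c′} → Adj c c′ → c ≢ c′
Adj⇒≢ (right x y) = i≢i+1 x ∘ cong proj₁
Adj⇒≢ (left x y) = i≢i+1 x ∘ sym ∘ cong proj₁
Adj⇒≢ (up x y) = i≢i+1 y ∘ cong proj₂
Adj⇒≢ (down x y) = i≢i+1 y ∘ sym ∘ cong proj₂

∈ᴰ-partner : ∀ δ {c} → c ∈ᴰ δ → ∃[ c′ ] (c′ ∈ᴰ δ × Adj c c′)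
∈ᴰ-partner (mkDomino a b a~b) (inj₁ refl) = b , inj₂ refl , a~b
∈ᴰ-partner (mkDomino a b a~b) (inj₂ refl) = a , inj₁ refl , Adj-sym a~b

DominoIn-∈ᴰ : ∀ {B δ c} → DominoIn B δ → c ∈ᴰ δ → c ∈ cells B
DominoIn-∈ᴰ (a∈B , _) (inj₁ refl) = a∈B
DominoIn-∈ᴰ (_ , b∈B) (inj₂ refl) = b∈B

module SaturatedCovering {B : CellSet} {D : List Domino} (saturated : IsSaturatedCovering B D) where

  privateCell : Fin (length D) → Cell
  privateCell i = proj₁ (proj₂ saturated i)

  privateCell-∈ : ∀ i → privateCell i ∈ cells B
  privateCell-∈ i = proj₁ (proj₂ (proj₂ saturated i))

  privateCell-only : ∀ i j → privateCell i ∈ᴰ lookup D j → j ≡ i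
  privateCell-only i j c∈δⱼ with j Fin.≟ i
  ... | yes j≡i = j≡i
  ... | no j≢i = ⊥-elim (proj₂ (proj₂ (proj₂ saturated i)) (Any-removeAt⁺ D i j j≢i c∈δⱼ))

  privateCell-own : ∀ i → privateCell i ∈ᴰ lookup D i
  privateCell-own i = subst (λ k → privateCell i ∈ᴰ lookup D k) (privateCell-only i _ c∈δ) c∈δ
    where
    c∈δ : privateCell i ∈ᴰ lookup D (Any.index (proj₂ (proj₁ saturated) (privateCell-∈ i)))
    c∈δ = Any.lookup-index (proj₂ (proj₁ saturated) (privateCell-∈ i))

  privateCell-injective : ∀ {i j} → privateCell i ≡ privateCell j → i ≡ j
  privateCell-injective {i} {j} cᵢ≡cⱼ =
    privateCell-only j i (subst (_∈ᴰ lookup D i) cᵢ≡cⱼ (privateCell-own i))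

  privateCells : List Cell
  privateCells = tabulate privateCell

  partner-∉-privateCells : ∀ i {c} → c ∈ᴰ lookup D i → Adj (privateCell i) c → c ∉ privateCells
  partner-∉-privateCells i c∈δᵢ cᵢ~c c∈P with ∈-tabulate⁻ c∈P
  ... | j , refl = Adj⇒≢ cᵢ~c (cong privateCell (privateCell-only j i c∈δᵢ))

  nonPrivateCells : CellSet
  nonPrivateCells = mkCellSet (filter (_∉? privateCells) (cells B)) (Unique.filter⁺ _ (unique B))

  nonPrivateCells-dominating : IsDominatingSet B nonPrivateCells
  nonPrivateCells-dominating = All.tabulate (proj₁ ∘ ∈-filter⁻ _) , dominates
    where
    dominates : ∀ {v} → v ∈ cells B → v ∈ cells nonPrivateCells ⊎ ∃[ u ] (u ∈ cells nonPrivateCells × Adj v u)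
    dominates {v} v∈B with v ∈? privateCells
    ... | no v∉P = inj₁ (∈-filter⁺ _ v∈B v∉P)
    ... | yes v∈P with ∈-tabulate⁻ v∈P
    ... | i , refl with ∈ᴰ-partner (lookup D i) (privateCell-own i)
    ... | c , c∈δᵢ , cᵢ~c =
      inj₂ (c , ∈-filter⁺ (_∉? privateCells) (DominoIn-∈ᴰ {B} {lookup D i} (All.lookup (proj₁ (proj₁ saturated)) (∈-lookup i)) c∈δᵢ)
                            (partner-∉-privateCells i c∈δᵢ cᵢ~c)
              , cᵢ~c)

  length+length-nonPrivateCells≤ : length D + length (cells nonPrivateCells) ≤ length (cells B)
  length+length-nonPrivateCells≤ =
    subst (λ n → n + length (cells nonPrivateCells) ≤ length (cells B)) (length-tabulate privateCell)
      (unique⊆⇒length+length-∉≤ (Unique.tabulate⁺ privateCell-injective) privateCells⊆B)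
    where
    privateCells⊆B : privateCells ⊆ cells B
    privateCells⊆B c∈P with ∈-tabulate⁻ c∈P
    ... | i , refl = privateCell-∈ i

firstCells-private : ∀ D → Unique (map fst D) → All (λ δ → snd δ ∉ map fst D) D →
                     ∀ i → ¬ Covered (removeAt D i) (fst (lookup D i))
firstCells-private (δ ∷ D) (fstδ∉ ∷ _) (_ ∷ snds∉) zero = All.All¬⇒¬Any (All.tabulate fstδ-missed)
  where
  fstδ-missed : ∀ {δ′} → δ′ ∈ D → ¬ fst δ ∈ᴰ δ′
  fstδ-missed δ′∈D (inj₁ fstδ≡fstδ′) = All.lookup fstδ∉ (∈-map⁺ fst δ′∈D) fstδ≡fstδ′
  fstδ-missed δ′∈D (inj₂ fstδ≡sndδ′) = All.lookup snds∉ δ′∈D (subst (_∈ map fst (δ ∷ D)) fstδ≡sndδ′ (here refl))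
firstCells-private (δ ∷ D) (fstδ∉ ∷ _) _ (suc i) (here (inj₁ c≡fstδ)) =
  All.lookup fstδ∉ (∈-map⁺ fst (∈-lookup i)) (sym c≡fstδ)
firstCells-private (δ ∷ D) _ (sndδ∉ ∷ _) (suc i) (here (inj₂ c≡sndδ)) =
  sndδ∉ (subst (_∈ map fst (δ ∷ D)) c≡sndδ (there (∈-map⁺ fst (∈-lookup i))))
firstCells-private (δ ∷ D) (_ ∷ fsts!) (_ ∷ snds∉) (suc i) (there c∈D) =
  firstCells-private D fsts! (All.map (_∘ there) snds∉) i c∈D

IsMinimumDominatingSet : CellSet → CellSet → Set
IsMinimumDominatingSet B S =
  IsDominatingSet B S × (∀ S′ → IsDominatingSet B S′ → length (cells S) ≤ length (cells S′))

module MinimumDominatingSet (B : CellSet) (board : IsBoard B) (S : CellSet)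
                            (minimum : IsMinimumDominatingSet B S) where

  S⊆B : cells S ⊆ cells B
  S⊆B = All.lookup (proj₁ (proj₁ minimum))

  outside : List Cell
  outside = filter (_∉? cells S) (cells B)

  outside-unique : Unique outside
  outside-unique = Unique.filter⁺ (_∉? cells S) (unique B)

  outside⊆B : outside ⊆ cells B
  outside⊆B = proj₁ ∘ ∈-filter⁻ (_∉? cells S) {xs = cells B}

  outside-∉ : ∀ {v} → v ∈ outside → v ∉ cells S
  outside-∉ = proj₂ ∘ ∈-filter⁻ (_∉? cells S) {xs = cells B}

  inside-or-outside : ∀ {v} → v ∈ cells B → v ∈ cells S ⊎ v ∈ outside
  inside-or-outside {v} v∈B with v ∈? cells S
  ... | yes v∈S = inj₁ v∈S
  ... | no v∉S = inj₂ (∈-filter⁺ (_∉? cells S) v∈B v∉S)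

  Dominates : List Cell → Set
  Dominates L = ∀ {v} → v ∈ cells B → v ∈ L ⊎ ∃[ u ] (u ∈ L × Adj v u)

  no-smaller-dominating : ∀ {L} → Unique L → L ⊆ cells B → Dominates L → length L < length (cells S) → ⊥
  no-smaller-dominating L! L⊆B dominates L<S =
    <⇒≱ L<S (proj₂ minimum (mkCellSet _ L!) (All.tabulate L⊆B , dominates))

  Feeds : (Cell → Cell) → Set
  Feeds p = ∀ {v} → v ∈ outside → p v ∈ cells S × Adj v (p v)

  Hits : (Cell → Cell) → Cell → Set
  Hits p s = ∃[ v ] (v ∈ outside × p v ≡ s)

  hits? : ∀ p s → Dec (Hits p s)
  hits? p s with any? (λ v → p v ≟ᶜ s) outside
  ... | yes hit = yes (find hit)
  ... | no ¬hit = no (λ (_ , v∈ , pv≡s) → ¬hit (lose v∈ pv≡s))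

  feeding : ∃ Feeds
  feeding = finiteChoice (0ℤ , 0ℤ) outside neighbourInS
    where
    neighbourInS : ∀ {v} → v ∈ outside → ∃[ u ] (u ∈ cells S × Adj v u)
    neighbourInS v∈ with proj₂ (proj₁ minimum) (outside⊆B v∈)
    ... | inj₁ v∈S = ⊥-elim (outside-∉ v∈ v∈S)
    ... | inj₂ u = u

  module Unhit {p} (feeds : Feeds p) {s} (s∈S : s ∈ cells S) (unhit : ¬ Hits p s) where

    fed-elsewhere : ∀ {v} → v ∈ outside → p v ≢ s
    fed-elsewhere v∈ pv≡s = unhit (_ , v∈ , pv≡s)

    no-neighbour-in-S : ∀ {w} → w ∈ cells S → ¬ Adj s w
    no-neighbour-in-S {w} w∈S s~w =
      no-smaller-dominating (remove-unique (unique S)) (S⊆B ∘ ∈-remove⁻) dominates (length-remove< s∈S)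
      where
      dominates : Dominates (remove s (cells S))
      dominates {v} v∈B with v ≟ᶜ s | inside-or-outside v∈B
      ... | yes refl | _ = inj₂ (w , ∈-remove⁺ w∈S (Adj⇒≢ s~w ∘ sym) , s~w)
      ... | no v≢s | inj₁ v∈S = inj₁ (∈-remove⁺ v∈S v≢s)
      ... | no _ | inj₂ v∈ = inj₂ (p v , ∈-remove⁺ (proj₁ (feeds v∈)) (fed-elsewhere v∈) , proj₂ (feeds v∈))

    -- Otherwise S − {s, p w} + {w} would dominate B.
    neighbour-shares-target : ∀ {w} → w ∈ outside → Adj s w → ∃[ v ] (v ∈ outside × v ≢ w × p v ≡ p w)
    neighbour-shares-target {w} w∈ s~w with any? (λ v → ¬? (v ≟ᶜ w) ×-dec (p v ≟ᶜ p w)) outside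
    ... | yes shared = let (v , v∈ , v≢w , pv≡pw) = find shared in v , v∈ , v≢w , pv≡pw
    ... | no ¬shared = ⊥-elim (no-smaller-dominating S′! S′⊆B dominates S′<S)
      where
      S′ : List Cell
      S′ = w ∷ remove (p w) (remove s (cells S))

      ∈S′ : ∀ {u} → u ∈ cells S → u ≢ s → u ≢ p w → u ∈ S′
      ∈S′ u∈S u≢s u≢pw = there (∈-remove⁺ (∈-remove⁺ u∈S u≢s) u≢pw)

      S′! : Unique S′
      S′! = All.tabulate (λ u∈ w≡u → outside-∉ w∈ (subst (_∈ cells S) (sym w≡u) (∈-remove⁻ (∈-remove⁻ u∈))))
            ∷ remove-unique (remove-unique (unique S))

      S′⊆B : S′ ⊆ cells B
      S′⊆B (here refl) = outside⊆B w∈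
      S′⊆B (there u∈) = S⊆B (∈-remove⁻ (∈-remove⁻ u∈))

      dominates : Dominates S′
      dominates {v} v∈B with v ≟ᶜ w | v ≟ᶜ s | v ≟ᶜ p w | inside-or-outside v∈B
      ... | yes v≡w | _ | _ | _ = inj₁ (here v≡w)
      ... | no _ | yes refl | _ | _ = inj₂ (w , here refl , s~w)
      ... | no _ | no _ | yes refl | _ = inj₂ (w , here refl , Adj-sym (proj₂ (feeds w∈)))
      ... | no _ | no v≢s | no v≢pw | inj₁ v∈S = inj₁ (∈S′ v∈S v≢s v≢pw)
      ... | no v≢w | no _ | no _ | inj₂ v∈ =
        inj₂ (p v , ∈S′ (proj₁ (feeds v∈)) (fed-elsewhere v∈) (λ pv≡pw → ¬shared (lose v∈ (v≢w , pv≡pw)))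
                  , proj₂ (feeds v∈))

      S′<S : length S′ < length (cells S)
      S′<S = ≤-trans (s≤s (length-remove< (∈-remove⁺ (proj₁ (feeds w∈)) (fed-elsewhere w∈))))
                     (length-remove< s∈S)

  hit : ∀ {p} → Feeds p → ∀ {s} → s ∈ cells S →
        ∃[ p′ ] (Feeds p′ × Hits p′ s × (∀ {t} → Hits p t → Hits p′ t))
  hit {p} feeds {s} s∈S with hits? p s
  ... | yes s-hit = p , feeds , s-hit , λ t-hit → t-hit
  ... | no unhit with board (S⊆B s∈S)
  ... | w , w∈B , s~w with inside-or-outside w∈B
  ... | inj₁ w∈S = ⊥-elim (Unhit.no-neighbour-in-S feeds s∈S unhit w∈S s~w)
  ... | inj₂ w∈ with Unhit.neighbour-shares-target feeds s∈S unhit w∈ s~w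
  ... | v , v∈ , v≢w , pv≡pw = p [ w ≔ s ] , feeds′ , (w , w∈ , update-≡ p {w} {s}) , still-hit
    where
    feeds′ : Feeds (p [ w ≔ s ])
    feeds′ {u} u∈ with u ≟ᶜ w
    ... | yes refl = s∈S , Adj-sym s~w
    ... | no _ = feeds u∈

    still-hit : ∀ {t} → Hits p t → Hits (p [ w ≔ s ]) t
    still-hit (u , u∈ , pu≡t) with u ≟ᶜ w
    ... | yes refl = v , v∈ , trans (update-≢ p v≢w) (trans pv≡pw pu≡t)
    ... | no u≢w = u , u∈ , trans (update-≢ p u≢w) pu≡t

  surjectiveFeeding : ∃[ p ] (Feeds p × (∀ {s} → s ∈ cells S → Hits p s))
  surjectiveFeeding = hitting (cells S) (λ s∈S → s∈S)
    where
    hitting : ∀ L → L ⊆ cells S → ∃[ p ] (Feeds p × (∀ {s} → s ∈ L → Hits p s))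
    hitting [] _ = proj₁ feeding , proj₂ feeding , λ ()
    hitting (s ∷ L) s∷L⊆S with hitting L (s∷L⊆S ∘ there)
    ... | p , feeds , hits-L with hit feeds (s∷L⊆S (here refl))
    ... | p′ , feeds′ , hits-s , still-hit =
      p′ , feeds′ , λ { (here refl) → hits-s ; (there t∈L) → still-hit (hits-L t∈L) }

  module Dominoes {p} (feeds : Feeds p) where

    domino : ∀ {v} → v ∈ outside → Domino
    domino {v} v∈ = mkDomino v (p v) (proj₂ (feeds v∈))

    dominoes : List Domino
    dominoes = mapWith∈ outside domino

    map-fst-dominoes : map fst dominoes ≡ outside
    map-fst-dominoes = trans (map-mapWith∈ outside domino fst) (mapWith∈-id outside)

    dominoes-in : All (DominoIn B) dominoes
    dominoes-in = All.tabulate λ δ∈ → case-domino (Any.mapWith∈⁻ outside domino δ∈)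
      where
      case-domino : ∀ {δ} → ∃[ v ] ∃[ v∈ ] δ ≡ domino {v} v∈ → DominoIn B δ
      case-domino (_ , v∈ , refl) = outside⊆B v∈ , S⊆B (proj₁ (feeds v∈))

    snd-∉-map-fst : All (λ δ → snd δ ∉ map fst dominoes) dominoes
    snd-∉-map-fst = All.tabulate λ δ∈ → case-domino (Any.mapWith∈⁻ outside domino δ∈)
      where
      case-domino : ∀ {δ} → ∃[ v ] ∃[ v∈ ] δ ≡ domino {v} v∈ → snd δ ∉ map fst dominoes
      case-domino (_ , v∈ , refl) pv∈ = outside-∉ (subst (_ ∈_) map-fst-dominoes pv∈) (proj₁ (feeds v∈))

    saturated : ∀ i → ∃[ c ] (c ∈ cells B × ¬ Covered (removeAt dominoes i) c)
    saturated i = fst (lookup dominoes i) , proj₁ (All.lookup dominoes-in (∈-lookup i))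
                , firstCells-private dominoes (subst Unique (sym map-fst-dominoes) outside-unique) snd-∉-map-fst i

    length-dominoes : length dominoes ≡ length outside
    length-dominoes = trans (sym (length-map fst dominoes)) (cong length map-fst-dominoes)

  saturatedCovering : ∃[ D ] (IsSaturatedCovering B D × length (cells B) ≤ length D + length (cells S))
  saturatedCovering = dominoes , ((dominoes-in , covers) , saturated) , counting
    where
    open Dominoes (proj₁ (proj₂ surjectiveFeeding))

    covers : ∀ {c} → c ∈ cells B → Covered dominoes c
    covers c∈B with inside-or-outside c∈B
    ... | inj₂ c∈ = Any.mapWith∈⁺ domino (_ , c∈ , inj₁ refl)
    ... | inj₁ c∈S with proj₂ (proj₂ surjectiveFeeding) c∈S
    ... | v , v∈ , pv≡c = Any.mapWith∈⁺ domino (v , v∈ , inj₂ (sym pv≡c))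

    counting : length (cells B) ≤ length dominoes + length (cells S)
    counting = begin
      length (cells B)                     ≤⟨ unique⇒length≤length+length-∉ (cells S) (unique B) ⟩
      length (cells S) + length outside    ≡⟨ +-comm (length (cells S)) (length outside) ⟩
      length outside + length (cells S)    ≡⟨ cong (_+ length (cells S)) length-dominoes ⟨
      length dominoes + length (cells S)   ∎
      where open ≤-Reasoning

mainTheorem15 : (B : CellSet) → IsBoard B → (g : ℕ) → IsDominationNumber B g →
                  IsMaxSaturatedSize B (length (cells B) ∸ g)
mainTheorem15 B board g ((S , S-dominating , refl) , minimal)
  with MinimumDominatingSet.saturatedCovering B board S (S-dominating , minimal)
... | D , D-saturated , B≤D+S = (D , D-saturated , ≤-antisym (upper D D-saturated) lower) , upper
  where
  upper : ∀ D′ → IsSaturatedCovering B D′ → length D′ ≤ length (cells B) ∸ length (cells S)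
  upper D′ D′-saturated = m+n≤o⇒m≤o∸n (length D′)
    (≤-trans (+-monoʳ-≤ (length D′) (minimal nonPrivateCells nonPrivateCells-dominating)) length+length-nonPrivateCells≤)
    where open SaturatedCovering {B} {D′} D′-saturated

  lower : length (cells B) ∸ length (cells S) ≤ length D
  lower = m≤n+o⇒m∸n≤o (length (cells B)) (length (cells S)) (subst (length (cells B) ≤_) (+-comm (length D) (length (cells S))) B≤D+S)
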